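{- Let $n>2$ be an integer with $n\equiv 2\pmod 4$. Then the polynomial $$f_{n,1}(x)=\sum_{j\geq 0}\binom{n-1}{2j+1}(x^j-x^{j+1})\in\mathbb{F}_2[x]$$ is not an irreducible self-reciprocal polynomial over $\mathbb{F}_2$.
   Context: Binomial coefficients $\binom{a}{b}$ are $0$ when $b>a$; coefficients are reduced modulo $2$. A nonzero polynomial $f$ of degree $d$ is self-reciprocal if $x^d f(1/x)=f(x)$. -}

module Defs where

open import Data.Bool using (Bool; true; false; _xor_; not; if_then_else_)
open import Data.Nat using (ℕ; zero; suc; _∸_; _%_; _*_; _+_; _≡ᵇ_; _≤_)
open import Data.Nat.Combinatorics using (_C_)
open import Data.List using (List; []; _∷_; length; reverse; dropWhileᵇ; map; foldr; upTo; replicate; _++_)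
open import Data.Product using (Σ; _×_)
open import Relation.Binary.PropositionalEquality using (_≡_; _≢_)
open import Relation.Nullary using (¬_)

-- Polynomials over F₂ = Bool (true = 1, false = 0, addition = xor),
-- represented by coefficient lists, lowest degree first.
Poly : Set
Poly = List Bool

coeff : Poly → ℕ → Bool
coeff []       _       = false
coeff (a ∷ p)  zero    = a
coeff (a ∷ p)  (suc i) = coeff p i

_≈_ : Poly → Poly → Set
p ≈ q = ∀ i → coeff p i ≡ coeff q i

_⊕_ : Poly → Poly → Poly
[]      ⊕ q       = q
(a ∷ p) ⊕ []      = a ∷ p
(a ∷ p) ⊕ (b ∷ q) = (a xor b) ∷ (p ⊕ q)

_⊗_ : Poly → Poly → Poly
[]      ⊗ q = []
(a ∷ p) ⊗ q = (if a then q else []) ⊕ (false ∷ (p ⊗ q))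

normalize : Poly → Poly
normalize p = reverse (dropWhileᵇ not (reverse p))

NonZero : Poly → Set
NonZero p = normalize p ≢ []

-- degree (only meaningful for nonzero polynomials)
deg : Poly → ℕ
deg p = length (normalize p) ∸ 1

-- reciprocal polynomial x^d f(1/x), d = deg f
reciprocal : Poly → Poly
reciprocal p = reverse (normalize p)

SelfReciprocal : Poly → Set
SelfReciprocal f = NonZero f × (reciprocal f ≈ f)

-- irreducible over F₂: nonconstant, and not a product of two
-- polynomials of positive degree (units of F₂[x] are the nonzero constants)
Irreducible : Poly → Set
Irreducible f =
  (1 ≤ deg f) ×
  (∀ g h → f ≈ (g ⊗ h) → ¬ ((1 ≤ deg g) × (1 ≤ deg h)))

monomial : ℕ → Poly
monomial j = replicate j false ++ (true ∷ [])

toF₂ : ℕ → Bool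
toF₂ m = (m % 2) ≡ᵇ 1

scale : Bool → Poly → Poly
scale c p = if c then p else []

-- f_{n,1}(x) = Σ_{j ≥ 0} C(n-1, 2j+1) (x^j - x^{j+1}) over F₂.
-- Terms with 2j+1 > n-1 vanish, so j ranges over 0 … n-1 suffices.
f₁ : ℕ → Poly
f₁ n = foldr _⊕_ []
  (map (λ j → scale (toF₂ ((n ∸ 1) C (2 * j + 1))) (monomial j ⊕ monomial (suc j)))
       (upTo n))

-- Every summand C(n-1,2j+1)(x^j + x^(j+1)) is a multiple of 1 + x, so over F₂
-- f_{n,1} = (1 + x) g with g = Σ_j C(n-1,2j+1) x^j.  For even n = 2k + 2 the
-- coefficient of x^k in g is C(2k+1,2k+1) = 1, so deg g ≥ k ≥ 1 once n > 2, and
-- f_{n,1} is reducible; it is not even necessary to use self-reciprocity.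
module Submission where

open import Defs
open import Data.Bool using (Bool; true; false; not; _∧_; _xor_)
open import Data.Bool.Properties using (∧-identityʳ; ∧-zeroʳ; xor-identityʳ; xor-∧-commutativeRing)
open import Algebra.Bundles using (CommutativeRing)
open import Algebra.Properties.CommutativeSemigroup
  (CommutativeRing.+-commutativeSemigroup xor-∧-commutativeRing) using (interchange)
open import Data.Nat using (ℕ; zero; suc; _+_; _*_; _∸_; _≤_; _<_; _%_; _/_; _≡ᵇ_; z≤n; s≤s; z<s)
open import Data.Nat.Properties
  using (≤-refl; ≤-trans; ≤-<-trans; <-irrefl; m<m+n; m≤n*m; +-∸-assoc; ∸-monoˡ-≤)
open import Data.Nat.DivMod using (m≡m%n+[m/n]*n)
open import Data.Nat.Combinatorics using (_C_; nCn≡1)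
open import Data.Nat.Tactic.RingSolver using (solve-∀)
open import Data.List using (List; []; _∷_; _++_; map; foldr; upTo; applyUpTo; length; reverse; dropWhileᵇ)
open import Data.List.Properties
  using (map-cong; map-∘; map-upTo; reverse-++; unfold-reverse; ++-assoc; length-reverse; length-++-≤ʳ)
open import Data.Product using (∃-syntax; _×_; _,_)
open import Function using (_∘_)
open import Relation.Binary.Bundles using (Setoid)
open import Relation.Binary.PropositionalEquality
  using (_≡_; refl; sym; trans; cong; cong₂; subst; subst₂; module ≡-Reasoning)
import Relation.Binary.Reasoning.Setoid as SetoidReasoning
open import Relation.Nullary using (¬_)
open import Data.Empty using (⊥-elim)

≈-refl : ∀ p → p ≈ p
≈-refl p i = refl

≈-setoid : Setoid _ _
≈-setoid = record
  { Carrier = Poly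
  ; _≈_ = _≈_
  ; isEquivalence = record
    { refl  = λ {p} → ≈-refl p
    ; sym   = λ p≈q i → sym (p≈q i)
    ; trans = λ p≈q q≈r i → trans (p≈q i) (q≈r i)
    }
  }

∷-cong : ∀ a p q → p ≈ q → (a ∷ p) ≈ (a ∷ q)
∷-cong a p q p≈q zero    = refl
∷-cong a p q p≈q (suc i) = p≈q i

coeff-⊕ : ∀ p q i → coeff (p ⊕ q) i ≡ coeff p i xor coeff q i
coeff-⊕ []      q       i       = refl
coeff-⊕ (a ∷ p) []      i       = sym (xor-identityʳ _)
coeff-⊕ (a ∷ p) (b ∷ q) zero    = refl
coeff-⊕ (a ∷ p) (b ∷ q) (suc i) = coeff-⊕ p q i

⊕-cong : ∀ p p′ q q′ → p ≈ p′ → q ≈ q′ → (p ⊕ q) ≈ (p′ ⊕ q′)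
⊕-cong p p′ q q′ p≈p′ q≈q′ i = begin
  coeff (p ⊕ q) i              ≡⟨ coeff-⊕ p q i ⟩
  coeff p i xor coeff q i      ≡⟨ cong₂ _xor_ (p≈p′ i) (q≈q′ i) ⟩
  coeff p′ i xor coeff q′ i    ≡⟨ coeff-⊕ p′ q′ i ⟨
  coeff (p′ ⊕ q′) i            ∎
  where open ≡-Reasoning

⊕-identityʳ : ∀ p → p ⊕ [] ≡ p
⊕-identityʳ []      = refl
⊕-identityʳ (a ∷ p) = refl

⊕-interchange : ∀ p q r s → ((p ⊕ q) ⊕ (r ⊕ s)) ≈ ((p ⊕ r) ⊕ (q ⊕ s))
⊕-interchange p q r s i = begin
  coeff ((p ⊕ q) ⊕ (r ⊕ s)) i
    ≡⟨ trans (coeff-⊕ (p ⊕ q) (r ⊕ s) i) (cong₂ _xor_ (coeff-⊕ p q i) (coeff-⊕ r s i)) ⟩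
  (coeff p i xor coeff q i) xor (coeff r i xor coeff s i)
    ≡⟨ interchange (coeff p i) (coeff q i) (coeff r i) (coeff s i) ⟩
  (coeff p i xor coeff r i) xor (coeff q i xor coeff s i)
    ≡⟨ trans (coeff-⊕ (p ⊕ r) (q ⊕ s) i) (cong₂ _xor_ (coeff-⊕ p r i) (coeff-⊕ q s i)) ⟨
  coeff ((p ⊕ r) ⊕ (q ⊕ s)) i
    ∎
  where open ≡-Reasoning

[false]≈[] : (false ∷ []) ≈ []
[false]≈[] zero    = refl
[false]≈[] (suc i) = refl

∑ : List Poly → Poly
∑ = foldr _⊕_ []

∑-cong : ∀ {A : Set} (T U : A → Poly) → (∀ a → T a ≈ U a) → ∀ l → ∑ (map T l) ≈ ∑ (map U l)
∑-cong T U T≈U []      = ≈-refl []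
∑-cong T U T≈U (a ∷ l) = ⊕-cong (T a) (U a) (∑ (map T l)) (∑ (map U l)) (T≈U a) (∑-cong T U T≈U l)

1+x : Poly
1+x = true ∷ true ∷ []

mul1+x : Poly → Poly
mul1+x p = p ⊕ (false ∷ p)

1+x⊗≈mul1+x : ∀ p → (1+x ⊗ p) ≈ mul1+x p
1+x⊗≈mul1+x p =
  ⊕-cong p p (false ∷ ((true ∷ []) ⊗ p)) (false ∷ p) (≈-refl p) (∷-cong false (p ⊕ (false ∷ [])) p p⊕[false]≈p)
  where
  p⊕[false]≈p : (p ⊕ (false ∷ [])) ≈ p
  p⊕[false]≈p = begin
    p ⊕ (false ∷ [])  ≈⟨ ⊕-cong p p (false ∷ []) [] (≈-refl p) [false]≈[] ⟩
    p ⊕ []            ≡⟨ ⊕-identityʳ p ⟩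
    p                 ∎
    where open SetoidReasoning ≈-setoid

mul1+x-⊕ : ∀ p q → mul1+x (p ⊕ q) ≈ (mul1+x p ⊕ mul1+x q)
mul1+x-⊕ p q = ⊕-interchange p q (false ∷ p) (false ∷ q)

mul1+x-∑ : ∀ ps → mul1+x (∑ ps) ≈ ∑ (map mul1+x ps)
mul1+x-∑ []       = [false]≈[]
mul1+x-∑ (p ∷ ps) = begin
  mul1+x (p ⊕ ∑ ps)                 ≈⟨ mul1+x-⊕ p (∑ ps) ⟩
  mul1+x p ⊕ mul1+x (∑ ps)          ≈⟨ ⊕-cong (mul1+x p) (mul1+x p) (mul1+x (∑ ps)) (∑ (map mul1+x ps))
                                               (≈-refl (mul1+x p)) (mul1+x-∑ ps) ⟩
  mul1+x p ⊕ ∑ (map mul1+x ps)      ∎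
  where open SetoidReasoning ≈-setoid

mul1+x-scale : ∀ c p → mul1+x (scale c p) ≈ scale c (mul1+x p)
mul1+x-scale true  p = ≈-refl (mul1+x p)
mul1+x-scale false p = [false]≈[]

-- Definitionally  monomial (suc j) = false ∷ monomial j,  so each summand of
-- f₁ is  scale c (mul1+x (monomial j)).
∑-scale-binomials≈1+x⊗ : ∀ (c : ℕ → Bool) l →
  ∑ (map (λ j → scale (c j) (monomial j ⊕ monomial (suc j))) l)
    ≈ (1+x ⊗ ∑ (map (λ j → scale (c j) (monomial j)) l))
∑-scale-binomials≈1+x⊗ c l = begin
  ∑ (map (λ j → scale (c j) (mul1+x (monomial j))) l)  ≈⟨ ∑-cong (mul1+x ∘ S) _ (λ j → mul1+x-scale (c j) (monomial j)) l ⟨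
  ∑ (map (mul1+x ∘ S) l)                                ≡⟨ cong ∑ (map-∘ l) ⟩
  ∑ (map mul1+x (map S l))                              ≈⟨ mul1+x-∑ (map S l) ⟨
  mul1+x (∑ (map S l))                                  ≈⟨ 1+x⊗≈mul1+x (∑ (map S l)) ⟨
  1+x ⊗ ∑ (map S l)                                     ∎
  where
  open SetoidReasoning ≈-setoid
  S : ℕ → Poly
  S j = scale (c j) (monomial j)

fromCoeffs : (ℕ → Bool) → ℕ → Poly
fromCoeffs c n = ∑ (map (λ j → scale (c j) (monomial j)) (upTo n))

xorSum : List Bool → Bool
xorSum = foldr _xor_ false

coeff-∑ : ∀ ps i → coeff (∑ ps) i ≡ xorSum (map (λ p → coeff p i) ps)
coeff-∑ []       i = refl
coeff-∑ (p ∷ ps) i = trans (coeff-⊕ p (∑ ps) i) (cong (coeff p i xor_) (coeff-∑ ps i))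

coeff-monomial : ∀ j i → coeff (monomial j) i ≡ (j ≡ᵇ i)
coeff-monomial zero    zero    = refl
coeff-monomial zero    (suc i) = refl
coeff-monomial (suc j) zero    = refl
coeff-monomial (suc j) (suc i) = coeff-monomial j i

coeff-scale-monomial : ∀ c j i → coeff (scale c (monomial j)) i ≡ (j ≡ᵇ i) ∧ c
coeff-scale-monomial true  j i = trans (coeff-monomial j i) (sym (∧-identityʳ (j ≡ᵇ i)))
coeff-scale-monomial false j i = sym (∧-zeroʳ (j ≡ᵇ i))

xorSum-falses : ∀ n → xorSum (applyUpTo (λ _ → false) n) ≡ false
xorSum-falses zero    = refl
xorSum-falses (suc n) = xorSum-falses n

-- The conjunction is written (j ≡ᵇ k) ∧ c j so that the terms with j ≠ k
-- reduce to false definitionally.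
xorSum-indicator : ∀ (c : ℕ → Bool) n k → k < n →
  xorSum (applyUpTo (λ j → (j ≡ᵇ k) ∧ c j) n) ≡ c k
xorSum-indicator c (suc n) zero    _         =
  trans (cong (c 0 xor_) (xorSum-falses n)) (xor-identityʳ (c 0))
xorSum-indicator c (suc n) (suc k) (s≤s k<n) = xorSum-indicator (c ∘ suc) n k k<n

coeff-fromCoeffs : ∀ c {n k} → k < n → coeff (fromCoeffs c n) k ≡ c k
coeff-fromCoeffs c {n} {k} k<n = begin
  coeff (fromCoeffs c n) k                                  ≡⟨ coeff-∑ (map S (upTo n)) k ⟩
  xorSum (map (λ p → coeff p k) (map S (upTo n)))           ≡⟨ cong xorSum (map-∘ (upTo n)) ⟨
  xorSum (map (λ j → coeff (S j) k) (upTo n))               ≡⟨ cong xorSum (map-cong (λ j → coeff-scale-monomial (c j) j k) (upTo n)) ⟩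
  xorSum (map (λ j → (j ≡ᵇ k) ∧ c j) (upTo n))              ≡⟨ cong xorSum (map-upTo _ n) ⟩
  xorSum (applyUpTo (λ j → (j ≡ᵇ k) ∧ c j) n)               ≡⟨ xorSum-indicator c n k k<n ⟩
  c k                                                       ∎
  where
  open ≡-Reasoning
  S : ℕ → Poly
  S j = scale (c j) (monomial j)

coeff≡true⇒split : ∀ p i → coeff p i ≡ true →
  ∃[ xs ] ∃[ ys ] (p ≡ xs ++ true ∷ ys) × (length xs ≡ i)
coeff≡true⇒split (true ∷ p)  zero    _ = [] , p , refl , refl
coeff≡true⇒split (a ∷ p)     (suc i) e with coeff≡true⇒split p i e
... | xs , ys , refl , refl = a ∷ xs , ys , refl , refl

length-dropWhileᵇ-not : ∀ l r → suc (length r) ≤ length (dropWhileᵇ not (l ++ true ∷ r))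
length-dropWhileᵇ-not []        r = ≤-refl
length-dropWhileᵇ-not (true ∷ l)  r = length-++-≤ʳ (true ∷ r) {true ∷ l}
length-dropWhileᵇ-not (false ∷ l) r = length-dropWhileᵇ-not l r

coeff≡true⇒≤deg : ∀ p i → coeff p i ≡ true → i ≤ deg p
coeff≡true⇒≤deg p i e with coeff≡true⇒split p i e
... | xs , ys , refl , refl = ∸-monoˡ-≤ 1 (subst (suc (length xs) ≤_) length-normalize bound)
  where
  reverse-split : reverse (xs ++ true ∷ ys) ≡ reverse ys ++ true ∷ reverse xs
  reverse-split = trans (reverse-++ xs (true ∷ ys))
    (trans (cong (_++ reverse xs) (unfold-reverse true ys)) (++-assoc (reverse ys) (true ∷ []) (reverse xs)))
  dropped : List Bool
  dropped = dropWhileᵇ not (reverse (xs ++ true ∷ ys))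
  length-normalize : length dropped ≡ length (normalize (xs ++ true ∷ ys))
  length-normalize = sym (length-reverse dropped)
  bound : suc (length xs) ≤ length dropped
  bound = subst₂ (λ m l → suc m ≤ length (dropWhileᵇ not l)) (length-reverse xs) (sym reverse-split)
                 (length-dropWhileᵇ-not (reverse ys) (reverse xs))

f₁-coeff : ℕ → ℕ → Bool
f₁-coeff n j = toF₂ ((n ∸ 1) C (2 * j + 1))

¬Irreducible-f₁-even : ∀ k → 1 ≤ k → ¬ Irreducible (f₁ (2 * k + 2))
¬Irreducible-f₁-even k 1≤k (_ , irreducible) =
  irreducible 1+x g (∑-scale-binomials≈1+x⊗ (f₁-coeff n) (upTo n))
    (coeff≡true⇒≤deg 1+x 1 refl , ≤-trans 1≤k (coeff≡true⇒≤deg g k coeff-g-k))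
  where
  n : ℕ
  n = 2 * k + 2
  g : Poly
  g = fromCoeffs (f₁-coeff n) n
  top-binomial : f₁-coeff n k ≡ true
  top-binomial = trans (cong (λ m → toF₂ (m C (2 * k + 1))) (+-∸-assoc (2 * k) {2} {1} (s≤s z≤n)))
                       (cong toF₂ (nCn≡1 (2 * k + 1)))
  coeff-g-k : coeff g k ≡ true
  coeff-g-k = trans (coeff-fromCoeffs (f₁-coeff n) (≤-<-trans (m≤n*m k 2) (m<m+n (2 * k) z<s))) top-binomial

n%4≡2⇒n≡2k+2 : ∀ n → 2 < n → n % 4 ≡ 2 → ∃[ k ] 1 ≤ k × n ≡ 2 * k + 2
n%4≡2⇒n≡2k+2 n 2<n n%4≡2 with n / 4 | trans (m≡m%n+[m/n]*n n 4) (cong (_+ (n / 4) * 4) n%4≡2)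
... | zero  | refl = ⊥-elim (<-irrefl refl 2<n)
... | suc q | n≡  = 2 * suc q , s≤s z≤n , trans n≡ (shape (suc q))
  where
  shape : ∀ q → 2 + q * 4 ≡ 2 * (2 * q) + 2
  shape = solve-∀

corollary4p2 : (n : ℕ) → 2 < n → n % 4 ≡ 2 →
    ¬ (Irreducible (f₁ n) × SelfReciprocal (f₁ n))
corollary4p2 n 2<n n%4≡2 (irreducible , _) with n%4≡2⇒n≡2k+2 n 2<n n%4≡2
... | k , 1≤k , refl = ¬Irreducible-f₁-even k 1≤k irreducible
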